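{- Let $H$ be a graph with an even number of vertices, let $V_M$ be the set of vertices covered by some maximum matching of $H$, and let $V_M^-=V(H)\setminus V_M$. Let $E^-$ be the set of edges of $H$ having at least one endpoint in $V_M^-$. Then every edge of $E^-$ has one endpoint in $V_M$ and the other in $V_M^-$ (i.e. $E^-=E(V_M,V_M^-)$), and $|E^-|\leq \frac{1}{2}|V_M|\,|V_M^-|$. -}

module Defs where

open import Data.Nat using (ℕ; zero; suc; _+_; _<ᵇ_)
open import Data.Bool using (Bool; true; false; if_then_else_; _∧_; _∨_; not)
open import Data.Fin using (Fin; toℕ) renaming (zero to fzero; suc to fsuc)
open import Relation.Binary.PropositionalEquality using (_≡_)
open import Data.Nat using (_≤_)

count : ∀ {n} → (Fin n → Bool) → ℕ
count {zero}  p = 0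
count {suc n} p = (if p fzero then 1 else 0) + count (λ i → p (fsuc i))

anyᵇ : ∀ {n} → (Fin n → Bool) → Bool
anyᵇ {zero}  p = false
anyᵇ {suc n} p = p fzero ∨ anyᵇ (λ i → p (fsuc i))

record Graph (n : ℕ) : Set where
  field
    adj    : Fin n → Fin n → Bool
    sym    : ∀ i j → adj i j ≡ adj j i
    irrefl : ∀ i → adj i i ≡ false
open Graph public

sumF : ∀ {n} → (Fin n → ℕ) → ℕ
sumF {zero}  f = 0
sumF {suc n} f = f fzero + sumF (λ i → f (fsuc i))

pairCount : ∀ {n} → (Fin n → Fin n → Bool) → ℕ
pairCount R = sumF (λ i → count (λ j → (toℕ i <ᵇ toℕ j) ∧ R i j))

edgeCount : ∀ {n} → Graph n → ℕ
edgeCount G = pairCount (adj G)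

record IsMatching {n : ℕ} (G : Graph n) (M : Fin n → Fin n → Bool) : Set where
  field
    sub     : ∀ i j → M i j ≡ true → adj G i j ≡ true
    msym    : ∀ i j → M i j ≡ M j i
    partner : ∀ i j k → M i j ≡ true → M i k ≡ true → j ≡ k

matchingSize : ∀ {n} → (Fin n → Fin n → Bool) → ℕ
matchingSize M = pairCount M

record IsMaximumMatching {n : ℕ} (G : Graph n) (M : Fin n → Fin n → Bool) : Set where
  field
    matching : IsMatching G M
    maximum  : ∀ M′ → IsMatching G M′ → matchingSize M′ ≤ matchingSize M

covered : ∀ {n} → (Fin n → Fin n → Bool) → Fin n → Bool
covered M i = anyᵇ (M i)

uncovered : ∀ {n} → (Fin n → Fin n → Bool) → Fin n → Bool
uncovered M i = not (covered M i)

EminusRel : ∀ {n} → Graph n → (Fin n → Fin n → Bool) → Fin n → Fin n → Bool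
EminusRel G M i j = adj G i j ∧ (uncovered M i ∨ uncovered M j)

EminusCount : ∀ {n} → Graph n → (Fin n → Fin n → Bool) → ℕ
EminusCount G M = pairCount (EminusRel G M)

module Submission where

-- If an edge joined two uncovered vertices, or a path v – i – k – u with ik ∈ M joined two
-- distinct uncovered vertices, exchanging it into M would give a matching covering more
-- vertices. The first fact says that every edge of E⁻ joins V_M to V_M⁻, so |E⁻| is the sum,
-- over covered i, of the number d⁻(i) of uncovered neighbours of i. The second gives
-- d⁻(i) + d⁻(k) ≤ |V_M⁻| for every ik ∈ M, since |V_M⁻| = n − 2|M| is even and hence never 1.
-- Summing over the edges of M yields 2|E⁻| ≤ |V_M| |V_M⁻|.

open import Defs renaming (sym to adj-sym)
open import Data.Nat using (ℕ; zero; suc; _+_; _*_; _≤_; _<_; z≤n; s≤s; _<ᵇ_)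
open import Data.Nat.Properties
open import Data.Nat.Divisibility using (_∣_; divides)
open import Data.Bool using (Bool; true; false; if_then_else_; _∧_; _∨_; not)
open import Data.Bool.Properties as Bool using (∨-zeroʳ; ∨-comm; ¬-not; not-¬)
open import Data.Fin using (Fin; toℕ) renaming (zero to fzero; suc to fsuc)
import Data.Fin.Properties as Fin
open import Data.Product using (_×_; _,_; ∃)
open import Data.Sum using (_⊎_; inj₁; inj₂)
open import Data.Empty using (⊥; ⊥-elim)
open import Function using (_∘_; mk⇔)
open import Relation.Binary.Definitions using (tri<; tri≈; tri>)
open import Relation.Binary.PropositionalEquality
open import Relation.Nullary using (¬_; Dec; yes; no; does; _because_; _×-dec_; _⊎-dec_)
open import Relation.Nullary.Decidable using (dec-true; dec-false; does-⇔)
open import Algebra.Properties.Semiring.Sum +-*-semiring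
  using (sum-syntax; sum-cong-≗; ∑-distrib-+; ∑-comm; *-distribˡ-sum; *-distribʳ-sum)

Relᵇ : ℕ → Set
Relᵇ n = Fin n → Fin n → Bool

𝟙 : Bool → ℕ
𝟙 b = if b then 1 else 0

𝟙-mono : ∀ {a b} → (a ≡ true → b ≡ true) → 𝟙 a ≤ 𝟙 b
𝟙-mono {false} _   = z≤n
𝟙-mono {true}  a⇒b rewrite a⇒b refl = ≤-refl

𝟙≤1 : ∀ b → 𝟙 b ≤ 1
𝟙≤1 false = z≤n
𝟙≤1 true  = ≤-refl

∨-true : ∀ a {b} → a ∨ b ≡ true → a ≡ true ⊎ b ≡ true
∨-true true  _ = inj₁ refl
∨-true false h = inj₂ h

∧-true : ∀ a {b} → a ∧ b ≡ true → a ≡ true × b ≡ true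
∧-true true h = refl , h

not-true : ∀ {b} → not b ≡ true → b ≡ false
not-true {false} _ = refl

𝟙-∧-disjoint : ∀ a b c → ¬ (a ≡ true × b ≡ true × c ≡ true) → 𝟙 (a ∧ c) + 𝟙 (b ∧ c) ≤ 𝟙 c
𝟙-∧-disjoint true  true  true  ¬abc = ⊥-elim (¬abc (refl , refl , refl))
𝟙-∧-disjoint true  false true  _    = ≤-refl
𝟙-∧-disjoint false true  true  _    = ≤-refl
𝟙-∧-disjoint false false _     _    = z≤n
𝟙-∧-disjoint true  true  false _    = z≤n
𝟙-∧-disjoint true  false false _    = z≤n
𝟙-∧-disjoint false true  false _    = z≤n

does⇒ : ∀ {ℓ} {A : Set ℓ} (A? : Dec A) → does A? ≡ true → A
does⇒ (yes a) _ = a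

<ᵇ-dec : ∀ m n → Dec (m < n)
<ᵇ-dec m n = (m <ᵇ n) because <ᵇ-reflects-< m n

anyᵇ-intro : ∀ {n} (p : Fin n → Bool) k → p k ≡ true → anyᵇ p ≡ true
anyᵇ-intro p fzero    pk rewrite pk = refl
anyᵇ-intro p (fsuc k) pk with p fzero
... | true  = refl
... | false = anyᵇ-intro (p ∘ fsuc) k pk

anyᵇ-witness : ∀ {n} (p : Fin n → Bool) → anyᵇ p ≡ true → ∃ λ k → p k ≡ true
anyᵇ-witness {suc n} p h with p fzero in p0
... | true  = fzero , p0
... | false with anyᵇ-witness (p ∘ fsuc) h
...   | k , pk = fsuc k , pk

count-mono : ∀ {n} {p q : Fin n → Bool} → (∀ j → p j ≡ true → q j ≡ true) → count p ≤ count q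
count-mono {zero}  p⊆q = z≤n
count-mono {suc n} p⊆q = +-mono-≤ (𝟙-mono (p⊆q fzero)) (count-mono (p⊆q ∘ fsuc))

count-mono-< : ∀ {n} {p q : Fin n → Bool} → (∀ j → p j ≡ true → q j ≡ true) →
  ∀ k → p k ≡ false → q k ≡ true → count p < count q
count-mono-< {suc n} p⊆q fzero    pk qk rewrite pk | qk = s≤s (count-mono (p⊆q ∘ fsuc))
count-mono-< {suc n} p⊆q (fsuc k) pk qk =
  +-mono-≤-< (𝟙-mono (p⊆q fzero)) (count-mono-< (p⊆q ∘ fsuc) k pk qk)

count-pos : ∀ {n} (p : Fin n → Bool) k → p k ≡ true → 1 ≤ count p
count-pos p fzero    pk rewrite pk = s≤s z≤n
count-pos p (fsuc k) pk = ≤-trans (count-pos (p ∘ fsuc) k pk) (m≤n+m _ _)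

count-false : ∀ {n} (p : Fin n → Bool) → (∀ j → p j ≡ false) → count p ≡ 0
count-false {zero}  p _  = refl
count-false {suc n} p pF rewrite pF fzero = count-false (p ∘ fsuc) (pF ∘ fsuc)

count-unique : ∀ {n} (p : Fin n → Bool) → (∀ j k → p j ≡ true → p k ≡ true → j ≡ k) →
  count p ≡ 𝟙 (anyᵇ p)
count-unique {zero}  p _ = refl
count-unique {suc n} p unique with p fzero in p0
... | true  = cong suc (count-false (p ∘ fsuc) (λ j → ¬-not λ pj → Fin.0≢1+n (unique _ _ p0 pj)))
... | false = count-unique (p ∘ fsuc) (λ j k pj pk → Fin.suc-injective (unique _ _ pj pk))

count-≤1 : ∀ {n} (p : Fin n → Bool) → (∀ j k → p j ≡ true → p k ≡ true → j ≡ k) → count p ≤ 1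
count-≤1 p unique = ≤-trans (≤-reflexive (count-unique p unique)) (𝟙≤1 _)

count-+-count-not : ∀ {n} (p : Fin n → Bool) → count p + count (not ∘ p) ≡ n
count-+-count-not {zero}  p = refl
count-+-count-not {suc n} p with p fzero
... | true  = cong suc (count-+-count-not (p ∘ fsuc))
... | false = trans (+-suc _ _) (cong suc (count-+-count-not (p ∘ fsuc)))

sumF≡∑ : ∀ {n} (f : Fin n → ℕ) → sumF f ≡ ∑[ i < n ] f i
sumF≡∑ {zero}  f = refl
sumF≡∑ {suc n} f = cong (f fzero +_) (sumF≡∑ (f ∘ fsuc))

count≡∑ : ∀ {n} (p : Fin n → Bool) → count p ≡ ∑[ i < n ] 𝟙 (p i)
count≡∑ {zero}  p = refl
count≡∑ {suc n} p = cong (𝟙 (p fzero) +_) (count≡∑ (p ∘ fsuc))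

∑-mono-≤ : ∀ {n} {f g : Fin n → ℕ} → (∀ i → f i ≤ g i) → ∑[ i < n ] f i ≤ ∑[ i < n ] g i
∑-mono-≤ {zero}  f≤g = z≤n
∑-mono-≤ {suc n} f≤g = +-mono-≤ (f≤g fzero) (∑-mono-≤ (f≤g ∘ fsuc))

count-+-≤ : ∀ {n} {p q r : Fin n → Bool} → (∀ j → 𝟙 (p j) + 𝟙 (q j) ≤ 𝟙 (r j)) →
  count p + count q ≤ count r
count-+-≤ {n} {p} {q} {r} pointwise = begin
  count p + count q                           ≡⟨ cong₂ _+_ (count≡∑ p) (count≡∑ q) ⟩
  ∑[ j < n ] 𝟙 (p j) + ∑[ j < n ] 𝟙 (q j)     ≡⟨ ∑-distrib-+ (𝟙 ∘ p) (𝟙 ∘ q) ⟨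
  ∑[ j < n ] (𝟙 (p j) + 𝟙 (q j))              ≤⟨ ∑-mono-≤ pointwise ⟩
  ∑[ j < n ] 𝟙 (r j)                          ≡⟨ count≡∑ r ⟨
  count r                                     ∎
  where open ≤-Reasoning

∑∑-symmetrize : ∀ {n} (f g : Fin n → Fin n → ℕ) → (∀ i j → g i j ≡ f i j + f j i) →
  ∑[ i < n ] ∑[ j < n ] g i j ≡ 2 * ∑[ i < n ] ∑[ j < n ] f i j
∑∑-symmetrize {n} f g g≡f+fᵀ = begin
  ∑[ i < n ] ∑[ j < n ] g i j                       ≡⟨ sum-cong-≗ row ⟩
  ∑[ i < n ] (∑[ j < n ] f i j + ∑[ j < n ] f j i)  ≡⟨ ∑-distrib-+ (λ i → ∑[ j < n ] f i j) _ ⟩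
  S + ∑[ i < n ] ∑[ j < n ] f j i                   ≡⟨ cong (S +_) (∑-comm (λ i j → f j i)) ⟩
  S + S                                             ≡⟨ cong (S +_) (+-identityʳ S) ⟨
  2 * S                                             ∎
  where
  open ≡-Reasoning
  S : ℕ
  S = ∑[ i < n ] ∑[ j < n ] f i j
  row : ∀ i → ∑[ j < n ] g i j ≡ ∑[ j < n ] f i j + ∑[ j < n ] f j i
  row i = trans (sum-cong-≗ (g≡f+fᵀ i)) (∑-distrib-+ (f i) (λ j → f j i))

handshake : ∀ {n} (R : Relᵇ n) → (∀ i j → R i j ≡ R j i) → (∀ i → R i i ≡ false) →
  2 * pairCount R ≡ ∑[ i < n ] count (R i)
handshake {n} R R-sym R-irrefl = begin
  2 * pairCount R                          ≡⟨ cong (2 *_) (sumF≡∑ (count ∘ R<)) ⟩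
  2 * ∑[ i < n ] count (R< i)              ≡⟨ cong (2 *_) (sum-cong-≗ (count≡∑ ∘ R<)) ⟩
  2 * ∑[ i < n ] ∑[ j < n ] 𝟙 (R< i j)     ≡⟨ ∑∑-symmetrize _ _ split ⟨
  ∑[ i < n ] ∑[ j < n ] 𝟙 (R i j)          ≡⟨ sum-cong-≗ (count≡∑ ∘ R) ⟨
  ∑[ i < n ] count (R i)                   ∎
  where
  open ≡-Reasoning
  R< : Relᵇ n
  R< i j = (toℕ i <ᵇ toℕ j) ∧ R i j
  split : ∀ i j → 𝟙 (R i j) ≡ 𝟙 (R< i j) + 𝟙 (R< j i)
  split i j with Fin.<-cmp i j
  ... | tri< i<j _ j≮i rewrite dec-true (<ᵇ-dec _ _) i<j | dec-false (<ᵇ-dec _ _) j≮i =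
    sym (+-identityʳ _)
  ... | tri> i≮j _ j<i rewrite dec-false (<ᵇ-dec _ _) i≮j | dec-true (<ᵇ-dec _ _) j<i =
    cong 𝟙 (R-sym i j)
  ... | tri≈ i≮i refl _ rewrite dec-false (<ᵇ-dec _ _) i≮i | R-irrefl i = refl

matched⇒covered : ∀ {n} (N : Relᵇ n) {x y} → N x y ≡ true → covered N x ≡ true
matched⇒covered N {x} {y} = anyᵇ-intro (N x) y

unmatched : ∀ {n} (N : Relᵇ n) {x y} → covered N x ≡ false → N x y ≢ true
unmatched N Cx Nxy = not-¬ (matched⇒covered N Nxy) Cx

adj⇒≢ : ∀ {n} (G : Graph n) {i j} → adj G i j ≡ true → i ≢ j
adj⇒≢ G {i} e refl = not-¬ e (irrefl G i)

module _ {n} {G : Graph n} {N : Relᵇ n} (N-matching : IsMatching G N) where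
  open IsMatching N-matching

  matching-irrefl : ∀ i → N i i ≡ false
  matching-irrefl i = ¬-not λ Nii → adj⇒≢ G (sub i i Nii) refl

  partners-count : ∀ i → count (N i) ≡ 𝟙 (covered N i)
  partners-count i = count-unique (N i) (partner i)

  2*size≡covered : 2 * matchingSize N ≡ count (covered N)
  2*size≡covered = begin
    2 * matchingSize N                ≡⟨ handshake N msym matching-irrefl ⟩
    ∑[ i < n ] count (N i)            ≡⟨ sum-cong-≗ partners-count ⟩
    ∑[ i < n ] 𝟙 (covered N i)        ≡⟨ count≡∑ (covered N) ⟨
    count (covered N)                 ∎
    where open ≡-Reasoning

  uncovered-count≢1 : 2 ∣ n → count (uncovered N) ≢ 1
  uncovered-count≢1 (divides q n≡q*2) U≡1 = even≢odd q (matchingSize N) (begin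
    2 * q                                     ≡⟨ *-comm 2 q ⟩
    q * 2                                     ≡⟨ n≡q*2 ⟨
    n                                         ≡⟨ count-+-count-not (covered N) ⟨
    count (covered N) + count (uncovered N)   ≡⟨ cong₂ _+_ (sym 2*size≡covered) U≡1 ⟩
    2 * matchingSize N + 1                    ≡⟨ +-comm _ 1 ⟩
    suc (2 * matchingSize N)                  ∎)
    where open ≡-Reasoning

  𝟙-covered-* : ∀ i x → 𝟙 (covered N i) * x ≡ ∑[ k < n ] (𝟙 (N i k) * x)
  𝟙-covered-* i x = begin
    𝟙 (covered N i) * x          ≡⟨ cong (_* x) (trans (sym (partners-count i)) (count≡∑ (N i))) ⟩
    (∑[ k < n ] 𝟙 (N i k)) * x   ≡⟨ *-distribʳ-sum x (𝟙 ∘ N i) ⟩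
    ∑[ k < n ] (𝟙 (N i k) * x)   ∎
    where open ≡-Reasoning

  -- Summing over matched ordered pairs (i, k) visits every covered vertex once as i and once as k.
  covered-weight-bound : (f : Fin n → ℕ) (c : ℕ) → (∀ i k → N i k ≡ true → f i + f k ≤ c) →
    2 * ∑[ i < n ] (𝟙 (covered N i) * f i) ≤ count (covered N) * c
  covered-weight-bound f c pair-bound = begin
    2 * ∑[ i < n ] (𝟙 (covered N i) * f i)           ≡⟨ cong (2 *_) (sum-cong-≗ λ i → 𝟙-covered-* i (f i)) ⟩
    2 * ∑[ i < n ] ∑[ k < n ] (𝟙 (N i k) * f i)      ≡⟨ ∑∑-symmetrize _ _ both-ends ⟨
    ∑[ i < n ] ∑[ k < n ] (𝟙 (N i k) * (f i + f k))  ≤⟨ ∑-mono-≤ (λ i → ∑-mono-≤ (λ k → bounded i k)) ⟩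
    ∑[ i < n ] ∑[ k < n ] (𝟙 (N i k) * c)            ≡⟨ sum-cong-≗ (λ i → 𝟙-covered-* i c) ⟨
    ∑[ i < n ] (𝟙 (covered N i) * c)                 ≡⟨ *-distribʳ-sum c (𝟙 ∘ covered N) ⟨
    (∑[ i < n ] 𝟙 (covered N i)) * c                 ≡⟨ cong (_* c) (count≡∑ (covered N)) ⟨
    count (covered N) * c                            ∎
    where
    open ≤-Reasoning
    both-ends : ∀ i k → 𝟙 (N i k) * (f i + f k) ≡ 𝟙 (N i k) * f i + 𝟙 (N k i) * f k
    both-ends i k rewrite msym k i = *-distribˡ-+ (𝟙 (N i k)) (f i) (f k)
    bounded : ∀ i k → 𝟙 (N i k) * (f i + f k) ≤ 𝟙 (N i k) * c
    bounded i k with N i k in Nik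
    ... | true  = *-monoʳ-≤ 1 (pair-bound i k Nik)
    ... | false = z≤n

IsEdge : ∀ {n} → Fin n → Fin n → Fin n → Fin n → Set
IsEdge a b x y = (x ≡ a × y ≡ b) ⊎ (x ≡ b × y ≡ a)

IsEdge? : ∀ {n} (a b x y : Fin n) → Dec (IsEdge a b x y)
IsEdge? a b x y = (x Fin.≟ a ×-dec y Fin.≟ b) ⊎-dec (x Fin.≟ b ×-dec y Fin.≟ a)

IsEdge-flip : ∀ {n} {a b x y : Fin n} → IsEdge a b x y → IsEdge a b y x
IsEdge-flip (inj₁ (p , q)) = inj₂ (q , p)
IsEdge-flip (inj₂ (p , q)) = inj₁ (q , p)

opaque
  edge : ∀ {n} → Fin n → Fin n → Relᵇ n
  edge a b x y = does (IsEdge? a b x y)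

  edge-introˡ : ∀ {n} (a b : Fin n) → edge a b a b ≡ true
  edge-introˡ a b = dec-true (IsEdge? a b a b) (inj₁ (refl , refl))

  edge-introʳ : ∀ {n} (a b : Fin n) → edge a b b a ≡ true
  edge-introʳ a b = dec-true (IsEdge? a b b a) (inj₂ (refl , refl))

  edge-view : ∀ {n} {a b x y : Fin n} → edge a b x y ≡ true → IsEdge a b x y
  edge-view {a = a} {b} {x} {y} = does⇒ (IsEdge? a b x y)

  edge-sym : ∀ {n} (a b x y : Fin n) → edge a b x y ≡ edge a b y x
  edge-sym a b x y = does-⇔ (mk⇔ IsEdge-flip IsEdge-flip) (IsEdge? a b x y) (IsEdge? a b y x)

_∪_ : ∀ {n} → Relᵇ n → Relᵇ n → Relᵇ n
(N₁ ∪ N₂) x y = N₁ x y ∨ N₂ x y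

∪-introˡ : ∀ {n} (N₁ N₂ : Relᵇ n) {x y} → N₁ x y ≡ true → (N₁ ∪ N₂) x y ≡ true
∪-introˡ N₁ N₂ h = cong (_∨ N₂ _ _) h

∪-introʳ : ∀ {n} (N₁ N₂ : Relᵇ n) {x y} → N₂ x y ≡ true → (N₁ ∪ N₂) x y ≡ true
∪-introʳ N₁ N₂ h = trans (cong (N₁ _ _ ∨_) h) (∨-zeroʳ _)

override : ∀ {n} → Relᵇ n → Relᵇ n → Relᵇ n
override N M x y = if covered N x then N x y else M x y

override-covered : ∀ {n} (N M : Relᵇ n) x → covered (override N M) x ≡ covered N x ∨ covered M x
override-covered N M x with covered N x in Cx
... | true  = Cx
... | false = refl

PartnerClosed : ∀ {n} → Relᵇ n → Relᵇ n → Set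
PartnerClosed N M = ∀ {x y z} → N x y ≡ true → M x z ≡ true → covered N z ≡ true

module _ {n} {G : Graph n} where

  edge-matching : ∀ a b → adj G a b ≡ true → IsMatching G (edge a b)
  edge-matching a b ab = record { sub = sub′ ; msym = edge-sym a b ; partner = partner′ }
    where
    sub′ : ∀ x y → edge a b x y ≡ true → adj G x y ≡ true
    sub′ x y e with edge-view e
    ... | inj₁ (refl , refl) = ab
    ... | inj₂ (refl , refl) = trans (adj-sym G b a) ab
    partner′ : ∀ x y z → edge a b x y ≡ true → edge a b x z ≡ true → y ≡ z
    partner′ x y z e e′ with edge-view e | edge-view e′
    ... | inj₁ (_ , refl) | inj₁ (_ , refl) = refl
    ... | inj₂ (_ , refl) | inj₂ (_ , refl) = refl
    ... | inj₁ (refl , _) | inj₂ (a≡b , _) = ⊥-elim (adj⇒≢ G ab a≡b)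
    ... | inj₂ (refl , _) | inj₁ (b≡a , _) = ⊥-elim (adj⇒≢ G ab (sym b≡a))

  ∪-matching : ∀ {N₁ N₂} → IsMatching G N₁ → IsMatching G N₂ →
    (∀ {x y z} → N₁ x y ≡ true → N₂ x z ≡ true → ⊥) → IsMatching G (N₁ ∪ N₂)
  ∪-matching {N₁} {N₂} N₁-matching N₂-matching disjoint =
    record { sub = sub′ ; msym = msym′ ; partner = partner′ }
    where
    module N₁ = IsMatching N₁-matching
    module N₂ = IsMatching N₂-matching
    sub′ : ∀ x y → (N₁ ∪ N₂) x y ≡ true → adj G x y ≡ true
    sub′ x y e with ∨-true (N₁ x y) e
    ... | inj₁ e₁ = N₁.sub x y e₁
    ... | inj₂ e₂ = N₂.sub x y e₂
    msym′ : ∀ x y → (N₁ ∪ N₂) x y ≡ (N₁ ∪ N₂) y x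
    msym′ x y = cong₂ _∨_ (N₁.msym x y) (N₂.msym x y)
    partner′ : ∀ x y z → (N₁ ∪ N₂) x y ≡ true → (N₁ ∪ N₂) x z ≡ true → y ≡ z
    partner′ x y z e e′ with ∨-true (N₁ x y) e | ∨-true (N₁ x z) e′
    ... | inj₁ e₁ | inj₁ e₁′ = N₁.partner x y z e₁ e₁′
    ... | inj₂ e₂ | inj₂ e₂′ = N₂.partner x y z e₂ e₂′
    ... | inj₁ e₁ | inj₂ e₂′ = ⊥-elim (disjoint e₁ e₂′)
    ... | inj₂ e₂ | inj₁ e₁′ = ⊥-elim (disjoint e₁′ e₂)

  override-matching : ∀ {N M} → IsMatching G N → IsMatching G M → PartnerClosed N M →
    IsMatching G (override N M)
  override-matching {N} {M} N-matching M-matching closed =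
    record { sub = sub′ ; msym = msym′ ; partner = partner′ }
    where
    module N = IsMatching N-matching
    module M = IsMatching M-matching
    sub′ : ∀ x y → override N M x y ≡ true → adj G x y ≡ true
    sub′ x y with covered N x
    ... | true  = N.sub x y
    ... | false = M.sub x y
    no-N-edge : ∀ {x y} → covered N y ≡ false → N x y ≡ false
    no-N-edge {x} {y} Cy = ¬-not λ Nxy → unmatched N Cy (trans (N.msym y x) Nxy)
    no-M-edge : ∀ {x y} → covered N x ≡ true → covered N y ≡ false → M y x ≡ false
    no-M-edge {x} {y} Cx Cy with anyᵇ-witness (N x) Cx
    ... | w , Nxw = ¬-not λ Myx → not-¬ (closed Nxw (trans (M.msym x y) Myx)) Cy
    msym′ : ∀ x y → override N M x y ≡ override N M y x
    msym′ x y with covered N x in Cx | covered N y in Cy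
    ... | true  | true  = N.msym x y
    ... | false | false = M.msym x y
    ... | true  | false = trans (no-N-edge Cy) (sym (no-M-edge Cx Cy))
    ... | false | true  = trans (no-M-edge Cy Cx) (sym (no-N-edge Cx))
    partner′ : ∀ x y z → override N M x y ≡ true → override N M x z ≡ true → y ≡ z
    partner′ x y z with covered N x
    ... | true  = N.partner x y z
    ... | false = M.partner x y z

module MaximumMatching {n} {G : Graph n} {M : Relᵇ n} (M-maximum : IsMaximumMatching G M) where
  open IsMaximumMatching M-maximum
  open IsMatching matching

  covered-≤ : ∀ {N} → IsMatching G N → count (covered N) ≤ count (covered M)
  covered-≤ N-matching = subst₂ _≤_ (2*size≡covered N-matching) (2*size≡covered matching)
    (*-monoʳ-≤ 2 (maximum _ N-matching))

  -- Otherwise override N M would be a matching covering strictly more vertices than M.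
  maximum-covers : ∀ {N} → IsMatching G N → PartnerClosed N M →
    ∀ {x y} → N x y ≡ true → covered M x ≡ true
  maximum-covers {N} N-matching closed {x} Nxy with covered M x in Cx
  ... | true  = refl
  ... | false = ⊥-elim (<⇒≱ more (covered-≤ (override-matching N-matching matching closed)))
    where
    more : count (covered M) < count (covered (override N M))
    more = count-mono-<
      (λ j Cj → trans (override-covered N M j) (trans (cong (covered N j ∨_) Cj) (∨-zeroʳ _)))
      x Cx (trans (override-covered N M x) (cong (_∨ covered M x) (matched⇒covered N Nxy)))

  uncovered-independent : ∀ {i j} → adj G i j ≡ true → covered M i ≡ false → covered M j ≡ false → ⊥
  uncovered-independent {i} {j} ij Ci Cj =
    not-¬ (maximum-covers (edge-matching i j ij) closed (edge-introˡ i j)) Ci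
    where
    closed : PartnerClosed (edge i j) M
    closed e Mxz with edge-view e
    ... | inj₁ (refl , _) = ⊥-elim (unmatched M Ci Mxz)
    ... | inj₂ (refl , _) = ⊥-elim (unmatched M Cj Mxz)

  no-augmenting-path₃ : ∀ {i k u v} → M i k ≡ true → adj G i v ≡ true → adj G k u ≡ true →
    covered M u ≡ false → covered M v ≡ false → v ≡ u
  no-augmenting-path₃ {i} {k} {u} {v} Mik iv ku Cu Cv with v Fin.≟ u
  ... | yes v≡u = v≡u
  ... | no  v≢u = ⊥-elim (not-¬ (maximum-covers N-matching closed Nuk) Cu)
    where
    N : Relᵇ n
    N = edge i v ∪ edge k u
    Mki : M k i ≡ true
    Mki = trans (msym k i) Mik
    disjoint : ∀ {x y z} → edge i v x y ≡ true → edge k u x z ≡ true → ⊥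
    disjoint e e′ with edge-view e | edge-view e′
    ... | inj₁ (refl , _) | inj₁ (i≡k , _) = adj⇒≢ G (sub i k Mik) i≡k
    ... | inj₁ (refl , _) | inj₂ (i≡u , _) = unmatched M Cu (subst (λ w → M w k ≡ true) i≡u Mik)
    ... | inj₂ (refl , _) | inj₁ (v≡k , _) = unmatched M Cv (subst (λ w → M w i ≡ true) (sym v≡k) Mki)
    ... | inj₂ (refl , _) | inj₂ (v≡u , _) = v≢u v≡u
    N-matching : IsMatching G N
    N-matching = ∪-matching (edge-matching i v iv) (edge-matching k u ku) disjoint
    Niv : N i v ≡ true
    Niv = ∪-introˡ (edge i v) (edge k u) (edge-introˡ i v)
    Nku : N k u ≡ true
    Nku = ∪-introʳ (edge i v) (edge k u) (edge-introˡ k u)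
    Nuk : N u k ≡ true
    Nuk = ∪-introʳ (edge i v) (edge k u) (edge-introʳ k u)
    closed : PartnerClosed N M
    closed {x} {y} {z} e Mxz with ∨-true (edge i v x y) e
    ... | inj₁ e₁ with edge-view e₁
    ...   | inj₁ (refl , _) rewrite partner i z k Mxz Mik = matched⇒covered N Nku
    ...   | inj₂ (refl , _) = ⊥-elim (unmatched M Cv Mxz)
    closed {x} {y} {z} e Mxz | inj₂ e₂ with edge-view e₂
    ...   | inj₁ (refl , _) rewrite partner k z i Mxz Mki = matched⇒covered N Niv
    ...   | inj₂ (refl , _) = ⊥-elim (unmatched M Cu Mxz)

  uncoveredNbr : Relᵇ n
  uncoveredNbr i j = adj G i j ∧ uncovered M j

  uncoveredDegree : Fin n → ℕ
  uncoveredDegree i = count (uncoveredNbr i)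

  -- If i and k share an uncovered neighbour it is the only uncovered neighbour of either;
  -- otherwise their uncovered neighbourhoods are disjoint.
  matched-pair-bound : count (uncovered M) ≢ 1 → ∀ i k → M i k ≡ true →
    uncoveredDegree i + uncoveredDegree k ≤ count (uncovered M)
  matched-pair-bound U≢1 i k Mik
    with Fin.any? (λ u → adj G i u Bool.≟ true ×-dec adj G k u Bool.≟ true ×-dec uncovered M u Bool.≟ true)
  ... | no ∄common = count-+-≤ λ v →
    𝟙-∧-disjoint (adj G i v) (adj G k v) (uncovered M v) (λ common → ∄common (v , common))
  ... | yes (u , iu , ku , Uu) = begin
    uncoveredDegree i + uncoveredDegree k
      ≤⟨ +-mono-≤ (count-≤1 (uncoveredNbr i) (only-u Mik ku)) (count-≤1 (uncoveredNbr k) (only-u Mki iu)) ⟩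
    2
      ≤⟨ ≤∧≢⇒< (count-pos (uncovered M) u Uu) (U≢1 ∘ sym) ⟩
    count (uncovered M) ∎
    where
    open ≤-Reasoning
    Mki : M k i ≡ true
    Mki = trans (msym k i) Mik
    only-u : ∀ {i′ k′} → M i′ k′ ≡ true → adj G k′ u ≡ true →
      ∀ v w → uncoveredNbr i′ v ≡ true → uncoveredNbr i′ w ≡ true → v ≡ w
    only-u {i′} Mik′ k′u v w v-nbr w-nbr = trans (to-u v-nbr) (sym (to-u w-nbr))
      where
      to-u : ∀ {x} → uncoveredNbr i′ x ≡ true → x ≡ u
      to-u {x} h with ∧-true (adj G i′ x) h
      ... | i′x , Ux = no-augmenting-path₃ Mik′ i′x k′u (not-true Uu) (not-true Ux)

  Eminus-endpoints : ∀ i j → EminusRel G M i j ≡ true →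
    (covered M i ≡ true × uncovered M j ≡ true) ⊎ (uncovered M i ≡ true × covered M j ≡ true)
  Eminus-endpoints i j e with adj G i j in ij | covered M i in Ci | covered M j in Cj
  Eminus-endpoints i j () | false | _     | _
  Eminus-endpoints i j () | true  | true  | true
  ... | true | true  | false = inj₁ (refl , refl)
  ... | true | false | true  = inj₂ (refl , refl)
  ... | true | false | false = ⊥-elim (uncovered-independent ij Ci Cj)

  Eminus-split : ∀ i j → 𝟙 (EminusRel G M i j) ≡
    𝟙 (covered M i) * 𝟙 (uncoveredNbr i j) + 𝟙 (covered M j) * 𝟙 (uncoveredNbr j i)
  Eminus-split i j rewrite adj-sym G j i with adj G i j in ij | covered M i in Ci | covered M j in Cj
  ... | false | ci    | cj    = sym (cong₂ _+_ (*-zeroʳ (𝟙 ci)) (*-zeroʳ (𝟙 cj)))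
  ... | true  | true  | true  = refl
  ... | true  | true  | false = refl
  ... | true  | false | true  = refl
  ... | true  | false | false = ⊥-elim (uncovered-independent ij Ci Cj)

  Eminus-count : EminusCount G M ≡ ∑[ i < n ] (𝟙 (covered M i) * uncoveredDegree i)
  Eminus-count = *-cancelˡ-≡ _ _ 2 (begin
    2 * EminusCount G M                              ≡⟨ handshake E E-sym E-irrefl ⟩
    ∑[ i < n ] count (E i)                           ≡⟨ sum-cong-≗ (λ i → count≡∑ (E i)) ⟩
    ∑[ i < n ] ∑[ j < n ] 𝟙 (E i j)                  ≡⟨ ∑∑-symmetrize _ _ Eminus-split ⟩
    2 * ∑[ i < n ] ∑[ j < n ] (𝟙 (covered M i) * 𝟙 (uncoveredNbr i j))
                                                     ≡⟨ cong (2 *_) (sum-cong-≗ row) ⟩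
    2 * ∑[ i < n ] (𝟙 (covered M i) * uncoveredDegree i) ∎)
    where
    open ≡-Reasoning
    E : Relᵇ n
    E = EminusRel G M
    E-sym : ∀ i j → E i j ≡ E j i
    E-sym i j = cong₂ _∧_ (adj-sym G i j) (∨-comm (uncovered M i) (uncovered M j))
    E-irrefl : ∀ i → E i i ≡ false
    E-irrefl i rewrite irrefl G i = refl
    row : ∀ i → ∑[ j < n ] (𝟙 (covered M i) * 𝟙 (uncoveredNbr i j)) ≡ 𝟙 (covered M i) * uncoveredDegree i
    row i = sym (begin
      𝟙 (covered M i) * uncoveredDegree i                  ≡⟨ cong (𝟙 (covered M i) *_) (count≡∑ (uncoveredNbr i)) ⟩
      𝟙 (covered M i) * ∑[ j < n ] 𝟙 (uncoveredNbr i j)   ≡⟨ *-distribˡ-sum (𝟙 (covered M i)) (𝟙 ∘ uncoveredNbr i) ⟩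
      ∑[ j < n ] (𝟙 (covered M i) * 𝟙 (uncoveredNbr i j)) ∎)

lemma5 : (n : ℕ) → 2 ∣ n → (G : Graph n) → (M : Fin n → Fin n → Bool) → IsMaximumMatching G M →
    ((i j : Fin n) → EminusRel G M i j ≡ true →
        (covered M i ≡ true × uncovered M j ≡ true) ⊎ (uncovered M i ≡ true × covered M j ≡ true))
    × (2 * EminusCount G M ≤ count (covered M) * count (uncovered M))
lemma5 n 2∣n G M M-maximum = Eminus-endpoints , (begin
  2 * EminusCount G M                                   ≡⟨ cong (2 *_) Eminus-count ⟩
  2 * ∑[ i < n ] (𝟙 (covered M i) * uncoveredDegree i)  ≤⟨ covered-weight-bound matching uncoveredDegree _
                                                             (matched-pair-bound (uncovered-count≢1 matching 2∣n)) ⟩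
  count (covered M) * count (uncovered M)               ∎)
  where
  open MaximumMatching M-maximum
  open IsMaximumMatching M-maximum using (matching)
  open ≤-Reasoning
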